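{- For all integers $k\ge2$ and $m\ge0$, $G(m\vec k)=C((m+1)\vec k)$; i.e. the Geode coefficient of $t_k^m$ equals the number of subdivisions of a roofed polygon into $m+1$ polygons each with $k+1$ sides.
   Context: A type is a vector $\mathbf m=[m_2,m_3,\ldots]$ of natural numbers (indices start at $2$) with finitely many nonzero entries; $\vec k$ is the type with $1$ in position $k$ and $0$ elsewhere, and $\mathbf t^{\mathbf m}=t_2^{m_2}t_3^{m_3}\cdots$. The hyper-Catalan number is $C_{\mathbf m}=\frac{(2m_2+3m_3+4m_4+\cdots)!}{(1+m_2+2m_3+3m_4+\cdots)!\,m_2!\,m_3!\cdots}$ (written $C(\mathbf m)$ when the index is an expression) and $\mathbf S=\sum_{\mathbf m}C_{\mathbf m}\mathbf t^{\mathbf m}$. The Geode $\mathbf G$ is the unique formal power series with $\mathbf S-1=(t_2+t_3+t_4+\cdots)\mathbf G$, and $G(\mathbf n)=G_{\mathbf n}$ is its coefficient of $\mathbf t^{\mathbf n}$. -}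

module Defs where

open import Data.Nat using (ℕ; zero; suc; _+_; _*_; _∸_; _!; _/_; NonZero)
open import Data.Nat.Properties using (_!≢0; m*n≢0)
open import Data.Integer using (ℤ; +_)
open import Data.Integer as ℤ using ()
open import Data.List using (List; []; _∷_; _++_; map; replicate; sum; foldr)

-- A type m = [m₂, m₃, m₄, …] is represented by the list whose j-th entry
-- (j = 0, 1, …) is m_{j+2}.  Lists differing only by trailing zeros denote
-- the same type; `strip` gives the canonical representative.
HType : Set
HType = List ℕ

consN : ℕ → List ℕ → List ℕ
consN zero    [] = []
consN (suc x) [] = suc x ∷ []
consN x (y ∷ ys) = x ∷ y ∷ ys

strip : HType → HType
strip []       = []
strip (x ∷ xs) = consN x (strip xs)

wsum : ℕ → List ℕ → ℕ
wsum c []       = 0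
wsum c (x ∷ xs) = c * x + wsum (suc c) xs

factProd : List ℕ → ℕ
factProd []       = 1
factProd (x ∷ xs) = x ! * factProd xs

factProd≢0 : ∀ l → NonZero (factProd l)
factProd≢0 []       = _
factProd≢0 (x ∷ xs) = m*n≢0 (x !) (factProd xs) {{x !≢0}} {{factProd≢0 xs}}

-- hyper-Catalan number
-- C_m = (2m₂+3m₃+⋯)! / ((1+m₂+2m₃+⋯)! m₂! m₃! ⋯)
hyperCatalan : HType → ℕ
hyperCatalan m =
  (wsum 2 m ! / ((suc (wsum 1 m)) ! * factProd m))
    {{m*n≢0 ((suc (wsum 1 m)) !) (factProd m) {{(suc (wsum 1 m)) !≢0}} {{factProd≢0 m}}}}

-- coefficient of t^m in S - 1  (as an integer)
coeffSminus1 : HType → ℤ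
coeffSminus1 m with strip m
... | []    = + 0
... | _ ∷ _ = + hyperCatalan m

decrements : HType → List HType
decrements []            = []
decrements (zero  ∷ xs)  = map (zero ∷_) (decrements xs)
decrements (suc x ∷ xs)  = (x ∷ xs) ∷ map (suc x ∷_) (decrements xs)

-- coefficient of t^m in (t₂ + t₃ + ⋯) · G, where G is given by its
-- coefficient function on (canonical) types
coeffTimesG : (HType → ℤ) → HType → ℤ
coeffTimesG G m = foldr ℤ._+_ (+ 0) (map (λ n → G (strip n)) (decrements m))

-- G is (the coefficient function of) the Geode:  S - 1 = (t₂ + t₃ + ⋯) G
IsGeode : (HType → ℤ) → Set
IsGeode G = ∀ (m : HType) → coeffSminus1 m ≡ coeffTimesG G m
  where open import Relation.Binary.PropositionalEquality using (_≡_)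

-- the type m·k⃗  (k ≥ 2): m in position k, zero elsewhere
scaledUnit : ℕ → ℕ → HType
scaledUnit m k = strip (replicate (k ∸ 2) 0 ++ (m ∷ []))

-- The type (m+1)·k⃗ has exactly one decrement, namely m·k⃗, so the coefficient of
-- t_k^(m+1) in (t₂ + t₃ + ⋯)·G is the single term G(m·k⃗), while in S − 1 it is
-- C((m+1)·k⃗).
module Submission where

open import Defs
open import Data.Nat using (ℕ; suc; zero; _≤_; _∸_)
open import Data.Integer using (ℤ; +_)
open import Data.Empty using (⊥-elim)
open import Data.Integer.Properties using (+-identityʳ)
open import Data.List using (List; []; _∷_; _++_; replicate; map)
open import Data.List.Properties using (++-conicalʳ)
open import Relation.Binary.PropositionalEquality using (_≡_; _≢_; refl; sym; cong)
open Relation.Binary.PropositionalEquality.≡-Reasoning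

singleAt : ℕ → ℕ → HType
singleAt j m = replicate j 0 ++ (m ∷ [])

strip-singleAt-suc : ∀ j m → strip (singleAt j (suc m)) ≡ singleAt j (suc m)
strip-singleAt-suc zero          m = refl
strip-singleAt-suc (suc zero)    m = refl
strip-singleAt-suc (suc (suc j)) m = cong (consN 0) (strip-singleAt-suc (suc j) m)

decrements-singleAt-suc : ∀ j m → decrements (singleAt j (suc m)) ≡ singleAt j m ∷ []
decrements-singleAt-suc zero    m = refl
decrements-singleAt-suc (suc j) m = cong (map (0 ∷_)) (decrements-singleAt-suc j m)

singleAt≢[] : ∀ j m → singleAt j m ≢ []
singleAt≢[] j m eq with ++-conicalʳ (replicate j 0) (m ∷ []) eq
... | ()

coeffSminus1-nonzero : ∀ l → strip l ≢ [] → coeffSminus1 l ≡ + hyperCatalan l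
coeffSminus1-nonzero l nonzero with strip l
... | []    = ⊥-elim (nonzero refl)
... | _ ∷ _ = refl

coeffTimesG-unique-decrement : ∀ (G : HType → ℤ) l {n} →
                               decrements l ≡ n ∷ [] → coeffTimesG G l ≡ G (strip n)
coeffTimesG-unique-decrement G l eq rewrite eq = +-identityʳ _

geode-unique-decrement : ∀ (G : HType → ℤ) → IsGeode G → ∀ l {n} →
                         decrements l ≡ n ∷ [] → strip l ≢ [] →
                         G (strip n) ≡ + hyperCatalan l
geode-unique-decrement G isGeode l {n} dec nonzero = begin
  G (strip n)       ≡⟨ sym (coeffTimesG-unique-decrement G l dec) ⟩
  coeffTimesG G l   ≡⟨ sym (isGeode l) ⟩
  coeffSminus1 l    ≡⟨ coeffSminus1-nonzero l nonzero ⟩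
  + hyperCatalan l  ∎

theorem7 : (G : HType → ℤ) → IsGeode G →
           ∀ (k m : ℕ) → 2 ≤ k →
           G (scaledUnit m k) ≡ + hyperCatalan (scaledUnit (suc m) k)
theorem7 G isGeode k m _ rewrite strip-singleAt-suc (k ∸ 2) m =
  geode-unique-decrement G isGeode (singleAt (k ∸ 2) (suc m))
    (decrements-singleAt-suc (k ∸ 2) m) nonzero
  where
  nonzero : strip (singleAt (k ∸ 2) (suc m)) ≢ []
  nonzero rewrite strip-singleAt-suc (k ∸ 2) m = singleAt≢[] (k ∸ 2) (suc m)
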